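{- Every Helly circular-arc graph with at least one edge contains an essential edge.
   Context: A Helly circular-arc graph is a graph $G$ admitting a map $\alpha$ from $V(G)$ to arcs of a discrete circle (arcs $[a,b]$ = points on the directed path from $a$ to $b$ on the cycle $1\to2\to\dots\to N\to1$) such that distinct $u,v$ are adjacent iff $\alpha(u)\cap\alpha(v)\ne\emptyset$, and the family of arcs has the Helly property (every family of pairwise intersecting arcs has a common point). A maxclique is an inclusion-maximal clique; an edge is essential if it lies in exactly one maxclique. -}

module Defs where

open import Data.Nat using (ℕ)
open import Data.Fin using (Fin; _≤_; _<_)
open import Data.Fin.Subset using (Subset; _∈_; _⊆_)
open import Data.Product using (_×_; ∃; ∃-syntax; _,_)
open import Data.Sum using (_⊎_)
open import Relation.Binary.PropositionalEquality using (_≡_; _≢_)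
open import Function.Bundles using (_⇔_)
open import Data.Empty using (⊥)

record Graph (n : ℕ) : Set₁ where
  field
    Adj     : Fin n → Fin n → Set
    sym     : ∀ {u v} → Adj u v → Adj v u
    irrefl  : ∀ {u} → Adj u u → ⊥
open Graph public

-- Discrete circle with N points: Fin N, oriented 0 → 1 → … → N-1 → 0.
-- An arc [a,b] is a pair (a , b); the point p lies on it iff p is on the
-- directed path from a to b.
Arc : ℕ → Set
Arc N = Fin N × Fin N

_onArc_ : ∀ {N} → Fin N → Arc N → Set
p onArc (a , b) = (a ≤ b × a ≤ p × p ≤ b) ⊎ (b < a × (a ≤ p ⊎ p ≤ b))

ArcsMeet : ∀ {N} → Arc N → Arc N → Set
ArcsMeet {N} A B = ∃[ p ] (p onArc A × p onArc B)

IsCAModel : ∀ {n} (G : Graph n) (N : ℕ) → (Fin n → Arc N) → Set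
IsCAModel {n} G N α = ∀ (u v : Fin n) → u ≢ v → (Adj G u v ⇔ ArcsMeet (α u) (α v))

IsHelly : ∀ {n N} → (Fin n → Arc N) → Set
IsHelly {n} {N} α =
  ∀ (S : Subset n) → (∃[ w ] w ∈ S) →
  (∀ u v → u ∈ S → v ∈ S → ArcsMeet (α u) (α v)) →
  ∃[ p ] (∀ u → u ∈ S → p onArc (α u))

IsHellyCA : ∀ {n} → Graph n → Set
IsHellyCA {n} G = ∃[ N ] ∃[ α ] (IsCAModel G N α × IsHelly {n} {N} α)

IsClique : ∀ {n} → Graph n → Subset n → Set
IsClique G C = ∀ u v → u ∈ C → v ∈ C → u ≢ v → Adj G u v

IsMaxClique : ∀ {n} → Graph n → Subset n → Set
IsMaxClique G C = IsClique G C × (∀ D → IsClique G D → C ⊆ D → D ≡ C)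

IsEssentialEdge : ∀ {n} → Graph n → Fin n → Fin n → Set
IsEssentialEdge G u v =
  Adj G u v ×
  ∃[ C ] ((IsMaxClique G C × u ∈ C × v ∈ C) ×
          (∀ C' → IsMaxClique G C' → u ∈ C' → v ∈ C' → C' ≡ C))

-- Fix a Helly circular-arc model α of G.  The argument rests on one
-- criterion: if the arcs meeting the "lens" α u ∩ α v of an edge uv
-- pairwise intersect, then by the Helly property they share a point r, and
-- {w | r ∈ α w} is the unique maxclique containing u and v (any clique
-- through u and v has a Helly point in the lens, so it lies inside).
-- Pairwise intersection holds when some point b is such that every arc
-- through the lens contains b or contains the whole lens.
--
-- To find such an edge, take a non-isolated vertex u whose arc [a,b] has the
-- fewest points.  A neighbour's arc cannot lie strictly inside [a,b], so every
-- neighbour avoiding b contains a.  If no neighbour avoids b, any edge at u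
-- works with anchor b; otherwise take the avoiding neighbour v whose arc ends
-- first after a: every other avoiding arc contains the lens of uv.
module Submission where

open import Defs
open import Data.Nat as ℕ using (ℕ; suc; s≤s)
open import Data.Nat.Properties
  using (≤-refl; ≤-trans; <⇒≤; ≰⇒>; <⇒≱; ≮⇒≥; <-≤-trans; ≤-<-trans)
open import Data.Fin using (Fin; _≟_; _≤?_; _<?_)
open import Data.Fin.Properties using (any?)
open import Data.Fin.Subset using (Subset; ∣_∣) renaming (_∈_ to _∈ₛ_; _⊆_ to _⊆ₛ_)
open import Data.Fin.Subset.Properties using (⊆-antisym; p⊂q⇒∣p∣<∣q∣)
open import Data.Vec using (tabulate)
open import Data.Vec.Properties using (lookup∘tabulate; []=⇒lookup; lookup⇒[]=)
open import Data.Bool.Properties using (T-≡)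
open import Data.Product using (_×_; _,_; ∃; ∃-syntax; proj₁; proj₂)
open import Data.Sum using (_⊎_; inj₁; inj₂)
open import Data.Empty using (⊥-elim)
open import Function using (_∘_)
open import Level using (0ℓ)
open import Function.Bundles using (Equivalence)
open import Relation.Nullary using (¬_; Dec; yes; no)
open import Relation.Nullary.Decidable using (isYes; toWitness; fromWitness; ¬?; _×-dec_; _⊎-dec_)
open import Relation.Unary using (Pred; Decidable)
open import Relation.Binary.PropositionalEquality using (_≡_; _≢_; refl; trans) renaming (sym to ≡-sym)

⟦_⟧ : ∀ {m} {P : Pred (Fin m) 0ℓ} → Decidable P → Subset m
⟦ P? ⟧ = tabulate (isYes ∘ P?)

∈⟦⟧⁺ : ∀ {m} {P : Pred (Fin m) 0ℓ} (P? : Decidable P) {x} → P x → x ∈ₛ ⟦ P? ⟧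
∈⟦⟧⁺ P? {x} px =
  lookup⇒[]= x _ (trans (lookup∘tabulate (isYes ∘ P?) x) (Equivalence.to T-≡ (fromWitness px)))

∈⟦⟧⁻ : ∀ {m} {P : Pred (Fin m) 0ℓ} (P? : Decidable P) {x} → x ∈ₛ ⟦ P? ⟧ → P x
∈⟦⟧⁻ P? {x} x∈ =
  toWitness {a? = P? x}
    (Equivalence.from T-≡ (trans (≡-sym (lookup∘tabulate (isYes ∘ P?) x)) ([]=⇒lookup x∈)))

Minimal : ∀ {m} → Pred (Fin m) 0ℓ → (Fin m → ℕ) → Fin m → Set
Minimal P f y = P y × (∀ z → P z → f y ℕ.≤ f z)

minimiser : ∀ {m} {P : Pred (Fin m) 0ℓ} → Decidable P → (f : Fin m → ℕ) →
            ∃ P → ∃ (Minimal P f)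
minimiser {P = P} P? f (x , px) = descend (suc (f x)) x ≤-refl px
  where
    descend : ∀ k x → f x ℕ.< k → P x → ∃ (Minimal P f)
    descend (suc k) x (s≤s fx≤k) px with any? (λ z → P? z ×-dec (f z ℕ.<? f x))
    ... | yes (z , pz , fz<fx) = descend k z (<-≤-trans fz<fx fx≤k) pz
    ... | no none = x , px , λ z pz → ≮⇒≥ (λ fz<fx → none (z , pz , fz<fx))

module _ {N : ℕ} where

  onArc? : (p : Fin N) (A : Arc N) → Dec (p onArc A)
  onArc? p (a , b) = (a ≤? b ×-dec a ≤? p ×-dec p ≤? b)
                     ⊎-dec (b <? a ×-dec (a ≤? p ⊎-dec p ≤? b))

  arcsMeet? : (A B : Arc N) → Dec (ArcsMeet A B)
  arcsMeet? A B = any? (λ p → onArc? p A ×-dec onArc? p B)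

  start-onArc : ∀ (a b : Fin N) → a onArc (a , b)
  start-onArc a b with a ≤? b
  ... | yes a≤b = inj₁ (a≤b , ≤-refl , a≤b)
  ... | no  a≰b = inj₂ (≰⇒> a≰b , inj₁ ≤-refl)

  end-onArc : ∀ (a b : Fin N) → b onArc (a , b)
  end-onArc a b with a ≤? b
  ... | yes a≤b = inj₁ (a≤b , a≤b , ≤-refl)
  ... | no  a≰b = inj₂ (≰⇒> a≰b , inj₂ ≤-refl)

  meets-itself : ∀ (A : Arc N) → ArcsMeet A A
  meets-itself (a , b) = a , start-onArc a b , start-onArc a b

  length : Arc N → ℕ
  length A = ∣ ⟦ (λ p → onArc? p A) ⟧ ∣

  shorter : ∀ (A B : Arc N) → (∀ q → q onArc A → q onArc B) →
            ∀ p → p onArc B → ¬ (p onArc A) → length A ℕ.< length B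
  shorter A B A⊆B p pB p∉A = p⊂q⇒∣p∣<∣q∣
    ( (λ {q} q∈ → ∈⟦⟧⁺ (λ x → onArc? x B) (A⊆B q (∈⟦⟧⁻ (λ x → onArc? x A) q∈)))
    , p , ∈⟦⟧⁺ (λ x → onArc? x B) pB , (λ p∈ → p∉A (∈⟦⟧⁻ (λ x → onArc? x A) p∈)) )

  common-start-⊆ : ∀ (a d d' q : Fin N) → d onArc (a , d') → q onArc (a , d) → q onArc (a , d')
  common-start-⊆ a d d' q (inj₁ (a≤d' , _ , d≤d')) (inj₁ (_ , a≤q , q≤d)) = inj₁ (a≤d' , a≤q , ≤-trans q≤d d≤d')
  common-start-⊆ a d d' q (inj₂ (d'<a , _)) (inj₁ (_ , a≤q , _)) = inj₂ (d'<a , inj₁ a≤q)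
  common-start-⊆ a d d' q (inj₁ (_ , a≤d , _)) (inj₂ (d<a , _)) = ⊥-elim (<⇒≱ d<a a≤d)
  common-start-⊆ a d d' q (inj₂ (_ , inj₁ a≤d)) (inj₂ (d<a , _)) = ⊥-elim (<⇒≱ d<a a≤d)
  common-start-⊆ a d d' q (inj₂ (d'<a , inj₂ _)) (inj₂ (_ , inj₁ a≤q)) = inj₂ (d'<a , inj₁ a≤q)
  common-start-⊆ a d d' q (inj₂ (d'<a , inj₂ d≤d')) (inj₂ (_ , inj₂ q≤d)) = inj₂ (d'<a , inj₂ (≤-trans q≤d d≤d'))

  common-start-total : ∀ (a d d' : Fin N) → d onArc (a , d') ⊎ d' onArc (a , d)
  common-start-total a d d' with a ≤? d | a ≤? d' | d ≤? d'
  ... | yes a≤d | yes a≤d' | yes d≤d' = inj₁ (inj₁ (a≤d' , a≤d , d≤d'))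
  ... | yes a≤d | yes a≤d' | no  d≰d' = inj₂ (inj₁ (a≤d , a≤d' , <⇒≤ (≰⇒> d≰d')))
  ... | yes a≤d | no  a≰d' | _        = inj₁ (inj₂ (≰⇒> a≰d' , inj₁ a≤d))
  ... | no  a≰d | yes a≤d' | _        = inj₂ (inj₂ (≰⇒> a≰d , inj₁ a≤d'))
  ... | no  a≰d | no  a≰d' | yes d≤d' = inj₁ (inj₂ (≰⇒> a≰d' , inj₂ d≤d'))
  ... | no  a≰d | no  a≰d' | no  d≰d' = inj₂ (inj₂ (≰⇒> a≰d , inj₂ (<⇒≤ (≰⇒> d≰d'))))

  ends-inside-or-longer : ∀ (a d d' : Fin N) → d onArc (a , d') ⊎ length (a , d') ℕ.< length (a , d)
  ends-inside-or-longer a d d' with onArc? d (a , d')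
  ... | yes d∈ = inj₁ d∈
  ... | no  d∉ with common-start-total a d d'
  ...   | inj₁ d∈  = ⊥-elim (d∉ d∈)
  ...   | inj₂ d'∈ = inj₂ (shorter (a , d') (a , d) (λ q → common-start-⊆ a d' d q d'∈) d (end-onArc a d) d∉)

  suffix-⊆ : ∀ (a c d q : Fin N) → a onArc (c , d) → q onArc (a , d) → q onArc (c , d)
  suffix-⊆ a c d q (inj₁ (c≤d , c≤a , a≤d)) (inj₁ (_ , a≤q , q≤d)) = inj₁ (c≤d , ≤-trans c≤a a≤q , q≤d)
  suffix-⊆ a c d q (inj₁ (_ , _ , a≤d)) (inj₂ (d<a , _)) = ⊥-elim (<⇒≱ d<a a≤d)
  suffix-⊆ a c d q (inj₂ (d<c , inj₁ c≤a)) (inj₁ (a≤d , _ , _)) = ⊥-elim (<⇒≱ d<c (≤-trans c≤a a≤d))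
  suffix-⊆ a c d q (inj₂ (d<c , inj₁ c≤a)) (inj₂ (_ , inj₁ a≤q)) = inj₂ (d<c , inj₁ (≤-trans c≤a a≤q))
  suffix-⊆ a c d q (inj₂ (d<c , inj₁ _)) (inj₂ (_ , inj₂ q≤d)) = inj₂ (d<c , inj₂ q≤d)
  suffix-⊆ a c d q (inj₂ (d<c , inj₂ _)) (inj₁ (_ , _ , q≤d)) = inj₂ (d<c , inj₂ q≤d)
  suffix-⊆ a c d q (inj₂ (_ , inj₂ a≤d)) (inj₂ (d<a , _)) = ⊥-elim (<⇒≱ d<a a≤d)

  overlap-⊆-suffix : ∀ (a b c d q : Fin N) → a onArc (c , d) → ¬ (b onArc (c , d)) →
                     q onArc (a , b) → q onArc (c , d) → q onArc (a , d)
  overlap-⊆-suffix a b c d q (inj₁ (c≤d , _)) b∉ _ (inj₂ (d<c , _)) = ⊥-elim (<⇒≱ d<c c≤d)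
  overlap-⊆-suffix a b c d q (inj₂ (d<c , _)) b∉ _ (inj₁ (c≤d , _)) = ⊥-elim (<⇒≱ d<c c≤d)
  overlap-⊆-suffix a b c d q (inj₁ (c≤d , c≤a , a≤d)) b∉ q∈ab (inj₁ (_ , c≤q , q≤d)) with a ≤? q
  ... | yes a≤q = inj₁ (a≤d , a≤q , q≤d)
  ... | no  a≰q with q∈ab
  ...   | inj₁ (_ , a≤q , _)     = ⊥-elim (a≰q a≤q)
  ...   | inj₂ (_ , inj₁ a≤q)    = ⊥-elim (a≰q a≤q)
  ...   | inj₂ (b<a , inj₂ q≤b) = ⊥-elim (b∉ (inj₁ (c≤d , ≤-trans c≤q q≤b , ≤-trans (<⇒≤ b<a) a≤d)))
  overlap-⊆-suffix a b c d q (inj₂ (d<c , inj₁ c≤a)) b∉ _ (inj₂ (_ , inj₂ q≤d)) = inj₂ (<-≤-trans d<c c≤a , inj₂ q≤d)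
  overlap-⊆-suffix a b c d q (inj₂ (d<c , inj₁ c≤a)) b∉ q∈ab (inj₂ (_ , inj₁ c≤q)) with a ≤? q
  ... | yes a≤q = inj₂ (<-≤-trans d<c c≤a , inj₁ a≤q)
  ... | no  a≰q with q∈ab
  ...   | inj₁ (_ , a≤q , _)     = ⊥-elim (a≰q a≤q)
  ...   | inj₂ (_ , inj₁ a≤q)    = ⊥-elim (a≰q a≤q)
  ...   | inj₂ (_ , inj₂ q≤b)    = ⊥-elim (b∉ (inj₂ (d<c , inj₁ (≤-trans c≤q q≤b))))
  overlap-⊆-suffix a b c d q (inj₂ (d<c , inj₂ a≤d)) b∉ (inj₂ (b<a , _)) _ with c ≤? b
  ... | yes c≤b = ⊥-elim (b∉ (inj₂ (d<c , inj₁ c≤b)))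
  ... | no  _   = ⊥-elim (b∉ (inj₂ (d<c , inj₂ (≤-trans (<⇒≤ b<a) a≤d))))
  overlap-⊆-suffix a b c d q (inj₂ (d<c , inj₂ a≤d)) b∉ (inj₁ (_ , a≤q , _)) (inj₂ (_ , inj₂ q≤d)) = inj₁ (a≤d , a≤q , q≤d)
  overlap-⊆-suffix a b c d q (inj₂ (d<c , inj₂ _)) b∉ (inj₁ (_ , _ , q≤b)) (inj₂ (_ , inj₁ c≤q)) = ⊥-elim (b∉ (inj₂ (d<c , inj₁ (≤-trans c≤q q≤b))))

  inside-if-ends-outside : ∀ (a b c d p q : Fin N) → p onArc (c , d) → p onArc (a , b) →
                           ¬ (a onArc (c , d)) → ¬ (b onArc (c , d)) → q onArc (c , d) → q onArc (a , b)
  inside-if-ends-outside a b c d p q (inj₁ (c≤d , _)) _ _ _ (inj₂ (d<c , _)) = ⊥-elim (<⇒≱ d<c c≤d)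
  inside-if-ends-outside a b c d p q (inj₂ (d<c , _)) _ _ _ (inj₁ (c≤d , _)) = ⊥-elim (<⇒≱ d<c c≤d)
  inside-if-ends-outside a b c d p q (inj₁ (c≤d , c≤p , p≤d)) (inj₁ (a≤b , a≤p , p≤b)) a∉ b∉ (inj₁ (_ , c≤q , q≤d))
    with c ≤? a | b ≤? d
  ... | yes c≤a | _       = ⊥-elim (a∉ (inj₁ (c≤d , c≤a , ≤-trans a≤p p≤d)))
  ... | no  _   | yes b≤d = ⊥-elim (b∉ (inj₁ (c≤d , ≤-trans c≤p p≤b , b≤d)))
  ... | no  c≰a | no  b≰d = inj₁ (a≤b , <⇒≤ (<-≤-trans (≰⇒> c≰a) c≤q) , <⇒≤ (≤-<-trans q≤d (≰⇒> b≰d)))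
  inside-if-ends-outside a b c d p q (inj₁ (c≤d , c≤p , p≤d)) (inj₂ (b<a , inj₁ a≤p)) a∉ b∉ (inj₁ (_ , c≤q , _))
    with c ≤? a
  ... | yes c≤a = ⊥-elim (a∉ (inj₁ (c≤d , c≤a , ≤-trans a≤p p≤d)))
  ... | no  c≰a = inj₂ (b<a , inj₁ (<⇒≤ (<-≤-trans (≰⇒> c≰a) c≤q)))
  inside-if-ends-outside a b c d p q (inj₁ (c≤d , c≤p , _)) (inj₂ (b<a , inj₂ p≤b)) a∉ b∉ (inj₁ (_ , _ , q≤d))
    with b ≤? d
  ... | yes b≤d = ⊥-elim (b∉ (inj₁ (c≤d , ≤-trans c≤p p≤b , b≤d)))
  ... | no  b≰d = inj₂ (b<a , inj₂ (<⇒≤ (≤-<-trans q≤d (≰⇒> b≰d))))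
  inside-if-ends-outside a b c d p q (inj₂ (d<c , inj₁ c≤p)) (inj₁ (_ , _ , p≤b)) _ b∉ _ = ⊥-elim (b∉ (inj₂ (d<c , inj₁ (≤-trans c≤p p≤b))))
  inside-if-ends-outside a b c d p q (inj₂ (d<c , inj₂ p≤d)) (inj₁ (_ , a≤p , _)) a∉ _ _ = ⊥-elim (a∉ (inj₂ (d<c , inj₂ (≤-trans a≤p p≤d))))
  inside-if-ends-outside a b c d p q (inj₂ (d<c , _)) (inj₂ (b<a , _)) a∉ _ (inj₂ (_ , inj₁ c≤q)) with c ≤? a
  ... | yes c≤a = ⊥-elim (a∉ (inj₂ (d<c , inj₁ c≤a)))
  ... | no  c≰a = inj₂ (b<a , inj₁ (<⇒≤ (<-≤-trans (≰⇒> c≰a) c≤q)))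
  inside-if-ends-outside a b c d p q (inj₂ (d<c , _)) (inj₂ (b<a , _)) _ b∉ (inj₂ (_ , inj₂ q≤d)) with b ≤? d
  ... | yes b≤d = ⊥-elim (b∉ (inj₂ (d<c , inj₂ b≤d)))
  ... | no  b≰d = inj₂ (b<a , inj₂ (<⇒≤ (≤-<-trans q≤d (≰⇒> b≰d))))

  inner-arc-shorter : ∀ (a b c d p : Fin N) → p onArc (c , d) → p onArc (a , b) →
                      ¬ (a onArc (c , d)) → ¬ (b onArc (c , d)) → length (c , d) ℕ.< length (a , b)
  inner-arc-shorter a b c d p p∈cd p∈ab a∉ b∉ =
    shorter (c , d) (a , b) (λ q → inside-if-ends-outside a b c d p q p∈cd p∈ab a∉ b∉) a (start-onArc a b) a∉

  lens-⊆ : ∀ (a b c d c' d' : Fin N) → a onArc (c , d) → ¬ (b onArc (c , d)) →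
           a onArc (c' , d') → d onArc (a , d') →
           ∀ q → q onArc (a , b) → q onArc (c , d) → q onArc (c' , d')
  lens-⊆ a b c d c' d' a∈cd b∉cd a∈c'd' d∈ad' q q∈ab q∈cd =
    suffix-⊆ a c' d' q a∈c'd' (common-start-⊆ a d d' q d∈ad' (overlap-⊆-suffix a b c d q a∈cd b∉cd q∈ab q∈cd))

module HellyModel {n : ℕ} (G : Graph n) {N : ℕ} (α : Fin n → Arc N)
                  (model : IsCAModel G N α) (helly : IsHelly {n} {N} α) where

  adj⇒≢ : ∀ {u v} → Adj G u v → u ≢ v
  adj⇒≢ uv refl = irrefl G uv

  adj⇒meet : ∀ {u v} → Adj G u v → ArcsMeet (α u) (α v)
  adj⇒meet {u} {v} uv = Equivalence.to (model u v (adj⇒≢ uv)) uv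

  meet⇒adj : ∀ {u v} → u ≢ v → ArcsMeet (α u) (α v) → Adj G u v
  meet⇒adj {u} {v} u≢v = Equivalence.from (model u v u≢v)

  adj? : ∀ u v → Dec (Adj G u v)
  adj? u v with u ≟ v
  ... | yes refl = no (irrefl G)
  ... | no  u≢v with arcsMeet? (α u) (α v)
  ...   | yes meet = yes (meet⇒adj u≢v meet)
  ...   | no  ¬meet = no (¬meet ∘ adj⇒meet)

  clique-meet : ∀ D → IsClique G D → ∀ w x → w ∈ₛ D → x ∈ₛ D → ArcsMeet (α w) (α x)
  clique-meet D D-clique w x w∈ x∈ with w ≟ x
  ... | yes refl = meets-itself (α w)
  ... | no  w≢x = adj⇒meet (D-clique w x w∈ x∈ w≢x)

  Through : Fin n → Fin n → Fin n → Set
  Through u v w = ∃[ p ] (p onArc α u × p onArc α v × p onArc α w)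

  Through? : ∀ u v → Decidable (Through u v)
  Through? u v w = any? (λ p → onArc? p (α u) ×-dec onArc? p (α v) ×-dec onArc? p (α w))

  ContainsLens : Fin n → Fin n → Fin n → Set
  ContainsLens u v w = ∀ q → q onArc α u → q onArc α v → q onArc α w

  -- Essential-edge criterion: if the arcs through the lens of the edge uv
  -- pairwise intersect, their Helly point r spans the only maxclique through
  -- u and v, since every clique through u and v has its Helly point in the lens.
  essential-criterion : ∀ {u v} → Adj G u v →
                        (∀ w x → Through u v w → Through u v x → ArcsMeet (α w) (α x)) →
                        IsEssentialEdge G u v
  essential-criterion {u} {v} uv through-meet = uv , M , (M-max , u∈M , v∈M) , unique
    where
      S : Subset n
      S = ⟦ Through? u v ⟧

      ends∈S : u ∈ₛ S × v ∈ₛ S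
      ends∈S with adj⇒meet uv
      ... | p , pu , pv = ∈⟦⟧⁺ (Through? u v) (p , pu , pv , pu) , ∈⟦⟧⁺ (Through? u v) (p , pu , pv , pv)

      S-helly : ∃[ r ] (∀ w → w ∈ₛ S → r onArc α w)
      S-helly = helly S (u , proj₁ ends∈S)
                  (λ w x w∈ x∈ → through-meet w x (∈⟦⟧⁻ (Through? u v) w∈) (∈⟦⟧⁻ (Through? u v) x∈))

      r : Fin N
      r = proj₁ S-helly

      M : Subset n
      M = ⟦ (λ w → onArc? r (α w)) ⟧

      S⊆M : ∀ {w} → w ∈ₛ S → w ∈ₛ M
      S⊆M {w} w∈S = ∈⟦⟧⁺ (λ w → onArc? r (α w)) (proj₂ S-helly w w∈S)

      u∈M : u ∈ₛ M
      u∈M = S⊆M (proj₁ ends∈S)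

      v∈M : v ∈ₛ M
      v∈M = S⊆M (proj₂ ends∈S)

      M-clique : IsClique G M
      M-clique w x w∈ x∈ w≢x =
        meet⇒adj w≢x (r , ∈⟦⟧⁻ (λ w → onArc? r (α w)) w∈ , ∈⟦⟧⁻ (λ w → onArc? r (α w)) x∈)

      -- A clique D through u and v has a Helly point q, which lies in the
      -- lens, so every member of D is in S and hence in M.
      ⊆M : ∀ D → IsClique G D → u ∈ₛ D → v ∈ₛ D → D ⊆ₛ M
      ⊆M D D-clique u∈D v∈D {w} w∈D =
        let (q , q∈) = helly D (u , u∈D) (clique-meet D D-clique)
        in S⊆M (∈⟦⟧⁺ (Through? u v) (q , q∈ u u∈D , q∈ v v∈D , q∈ w w∈D))

      M-max : IsMaxClique G M
      M-max = M-clique , λ D D-clique M⊆D → ⊆-antisym (⊆M D D-clique (M⊆D u∈M) (M⊆D v∈M)) M⊆D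

      unique : ∀ C → IsMaxClique G C → u ∈ₛ C → v ∈ₛ C → C ≡ M
      unique C (C-clique , C-max) u∈C v∈C = ≡-sym (C-max M M-clique (⊆M C C-clique u∈C v∈C))

  essential-by-anchor : ∀ {u v} → Adj G u v → (b : Fin N) →
                        (∀ w → Through u v w → b onArc α w ⊎ ContainsLens u v w) →
                        IsEssentialEdge G u v
  essential-by-anchor {u} {v} uv b anchored = essential-criterion uv through-meet
    where
      through-meet : ∀ w x → Through u v w → Through u v x → ArcsMeet (α w) (α x)
      through-meet w x tw@(p , pu , pv , pw) tx@(p' , p'u , p'v , p'x) with anchored w tw | anchored x tx
      ... | inj₁ b∈w | inj₁ b∈x = b , b∈w , b∈x
      ... | inj₂ w⊇  | _        = p' , w⊇ p' p'u p'v , p'x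
      ... | inj₁ _   | inj₂ x⊇  = p , pw , x⊇ p pu pv

  NonIsolated : Fin n → Set
  NonIsolated w = ∃[ x ] Adj G w x

  module ShortestArc (u : Fin n) (u-min : ∀ z → NonIsolated z → length (α u) ℕ.≤ length (α z)) where

    a b : Fin N
    a = proj₁ (α u)
    b = proj₂ (α u)

    Avoider : Fin n → Set
    Avoider w = Adj G u w × ¬ (b onArc α w)

    Avoider? : Decidable Avoider
    Avoider? w = adj? u w ×-dec ¬? (onArc? b (α w))

    through⇒avoider : ∀ {v w} → Through u v w → ¬ (b onArc α w) → Avoider w
    through⇒avoider {w = w} (p , pu , _ , pw) b∉w with u ≟ w
    ... | yes refl = ⊥-elim (b∉w (end-onArc a b))
    ... | no  u≢w  = meet⇒adj u≢w (p , pu , pw) , b∉w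

    -- By minimality of α u no neighbour's arc lies inside it, so avoiders contain a.
    avoider-contains-a : ∀ {w} → Avoider w → a onArc α w
    avoider-contains-a {w} (uw , b∉w) with onArc? a (α w)
    ... | yes a∈w = a∈w
    ... | no  a∉w with adj⇒meet uw
    ...   | p , pu , pw =
      ⊥-elim (<⇒≱ (inner-arc-shorter a b (proj₁ (α w)) (proj₂ (α w)) p pw pu a∉w b∉w)
                  (u-min w (u , Graph.sym G uw)))

    essential-if-avoiders-contain-lens : ∀ {v} → Adj G u v → (∀ w → Avoider w → ContainsLens u v w) →
                                         IsEssentialEdge G u v
    essential-if-avoiders-contain-lens {v} uv avoiders⊇ = essential-by-anchor uv b anchored
      where
        anchored : ∀ w → Through u v w → b onArc α w ⊎ ContainsLens u v w
        anchored w tw with onArc? b (α w)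
        ... | yes b∈w = inj₁ b∈w
        ... | no  b∉w = inj₂ (avoiders⊇ w (through⇒avoider tw b∉w))

    reach : Fin n → ℕ
    reach w = length (a , proj₂ (α w))

    nearest-avoider-lens : ∀ {v} → Minimal Avoider reach v → ∀ w → Avoider w → ContainsLens u v w
    nearest-avoider-lens {v} (v-avoids , v-min) w w-avoids =
      lens-⊆ a b (proj₁ (α v)) d (proj₁ (α w)) d' (avoider-contains-a v-avoids) (proj₂ v-avoids)
             (avoider-contains-a w-avoids) d∈ad'
      where
        d = proj₂ (α v)
        d' = proj₂ (α w)
        d∈ad' : d onArc (a , d')
        d∈ad' with ends-inside-or-longer a d d'
        ... | inj₁ d∈  = d∈
        ... | inj₂ lt = ⊥-elim (<⇒≱ lt (v-min w w-avoids))

    essential-edge-at-u : NonIsolated u → ∃[ v ] IsEssentialEdge G u v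
    essential-edge-at-u (x , ux) with any? Avoider?
    ... | no  none = x , essential-if-avoiders-contain-lens ux (λ w w-avoids → ⊥-elim (none (w , w-avoids)))
    ... | yes some =
      let (v , v-nearest) = minimiser Avoider? reach some
      in v , essential-if-avoiders-contain-lens (proj₁ (proj₁ v-nearest)) (nearest-avoider-lens v-nearest)

  NonIsolated? : Decidable NonIsolated
  NonIsolated? w = any? (adj? w)

  essential-edge : ∃ NonIsolated → ∃[ u ] ∃[ v ] IsEssentialEdge G u v
  essential-edge some =
    let (u , u-nonisolated , u-min) = minimiser NonIsolated? (length ∘ α) some
    in u , ShortestArc.essential-edge-at-u u u-min u-nonisolated

lemma16 : ∀ (n : ℕ) (G : Graph n) → IsHellyCA G →
          (∃[ u ] ∃[ v ] Adj G u v) →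
          ∃[ u ] ∃[ v ] IsEssentialEdge G u v
lemma16 n G (N , α , model , helly) (u₀ , edge) =
  HellyModel.essential-edge G α model helly (u₀ , edge)
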